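{- Let $L$ be a finite atomistic lattice, with $\xi$ and $\mathcal{T}_L$ as in the context. The following are equivalent: (i) $L\cong\mathrm{Fl}\,\mathcal{H}$ for some boolean representable simplicial complex $\mathcal{H}$; (ii) $L\cong\mathrm{Fl}\,\mathcal{T}_L$; (iii) the map $\xi:L\to\mathrm{Fl}\,\mathcal{T}_L$, $x\mapsto x\xi$, is onto; (iv) $(\bigvee F)\xi\subseteq F$ for every flat $F$ of $\mathcal{T}_L$, where $\bigvee F$ is the join in $L$ of the atoms in $F$. Moreover, if $\mathcal{H}=(V,H)$ is a boolean representable simplicial complex with $L\cong\mathrm{Fl}\,\mathcal{H}$, then $\mathcal{T}_L$ is isomorphic to a restriction $\mathcal{H}|_W=(W,H\cap 2^W)$ of $\mathcal{H}$ for some $W\subseteq V$, and if $\mathcal{H}$ is simple then $\mathcal{T}_L$ is isomorphic to $\mathcal{H}$.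
   Context: A (finite) simplicial complex is a pair $(V,H)$ with $V$ finite nonempty and $H\subseteq 2^V$ nonempty and closed under subsets; two complexes $(V,H)$, $(V',H')$ are isomorphic if there is a bijection $\varphi:V\to V'$ with $X\in H\iff X\varphi\in H'$ for all $X\subseteq V$. A subset $X\subseteq V$ is a flat if for every $I\in H$ with $I\subseteq X$ and every $p\in V\setminus X$ we have $I\cup\{p\}\in H$; flats ordered by inclusion form the lattice $\mathrm{Fl}$. A set $X$ is a transversal of the successive differences for a chain of subsets $A_0\subset\cdots\subset A_k$ if $X$ has an enumeration $x_1,\dots,x_k$ with $x_i\in A_i\setminus A_{i-1}$; $(V,H)$ is boolean representable if every $X\in H$ is such a transversal for some chain of flats. $(V,H)$ is simple if every subset of $V$ with at most two elements lies in $H$. For a finite lattice $L$, $\mathrm{At}(L)$ is the set of atoms; $L$ is atomistic if every element is a join of atoms. For $x\in L$, $x\xi=\{a\in\mathrm{At}(L)\mid a\le x\}$. $T_L$ is the set of all $A\subseteq\mathrm{At}(L)$ admitting an enumeration $a_1,\dots,a_m$ and a chain $x_0<x_1<\cdots<x_m$ in $L$ with $a_i\in x_i\xi\setminus x_{i-1}\xi$ for all $i$; $\mathcal{T}_L=(\mathrm{At}(L),T_L)$. -}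

module Defs where

open import Level using (0ℓ)
open import Data.Nat using (ℕ; suc)
open import Data.Fin using (Fin; inject₁) renaming (suc to fsuc)
open import Data.Fin.Properties using () renaming (_≟_ to _≟ᶠ_)
open import Data.Bool using (Bool; true; false; T; not; _∧_; _∨_; if_then_else_)
open import Data.List using (List; foldr; allFin)
open import Data.Product using (Σ; Σ-syntax; ∃; ∃-syntax; _×_; _,_; proj₁)
open import Data.Sum using (_⊎_)
open import Data.Unit using (tt)
open import Relation.Nullary using (¬_)
open import Relation.Nullary.Decidable using (⌊_⌋)
open import Relation.Binary.PropositionalEquality using (_≡_)
open import Function.Definitions using (Injective)
open import Function.Bundles using (_↔_; _⇔_; Inverse)
import Relation.Binary.Lattice.Structures as LS

Subset : Set → Set
Subset V = V → Bool

module _ {V : Set} where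

  _∈_ : V → Subset V → Set
  v ∈ X = T (X v)

  _∉_ : V → Subset V → Set
  v ∉ X = ¬ (v ∈ X)

  _⊆_ : Subset V → Subset V → Set
  X ⊆ Y = ∀ v → v ∈ X → v ∈ Y

  _⊂_ : Subset V → Subset V → Set
  X ⊂ Y = X ⊆ Y × ¬ (Y ⊆ X)

  _≐_ : Subset V → Subset V → Set
  X ≐ Y = X ⊆ Y × Y ⊆ X

  -- X is a transversal of the successive differences of the chain
  -- A 0 , A 1 , ... , A k : X has an enumeration x 0 .. x (k-1)
  -- (an injective listing of exactly the elements of X) with
  -- x i ∈ A (i+1) ∖ A i.
  IsTransversal : Subset V → (k : ℕ) → (Fin (suc k) → Subset V) → Set
  IsTransversal X k A =
    Σ[ x ∈ (Fin k → V) ]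
      Injective _≡_ _≡_ x
      × (∀ v → (v ∈ X) ⇔ (∃[ i ] x i ≡ v))
      × (∀ i → (x i ∈ A (fsuc i)) × (x i ∉ A (inject₁ i)))

record Complex : Set₁ where
  field
    V : Set
    H : Subset V → Set
open Complex public

Finite : Set → Set
Finite V = Σ[ k ∈ ℕ ] (V ↔ Fin k)

IsSimplicialComplex : Complex → Set
IsSimplicialComplex C =
  Finite (V C) × V C × (Σ[ X ∈ Subset (V C) ] H C X)
  × (∀ X Y → X ⊆ Y → H C Y → H C X)

IsFlat : (C : Complex) → Subset (V C) → Set
IsFlat C X =
  ∀ I → H C I → I ⊆ X → ∀ p → p ∉ X →
    ∀ J → (∀ v → (v ∈ J) ⇔ ((v ∈ I) ⊎ (v ≡ p))) → H C J

BooleanRepresentable : Complex → Set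
BooleanRepresentable C =
  ∀ X → H C X →
    Σ[ k ∈ ℕ ] Σ[ A ∈ (Fin (suc k) → Subset (V C)) ]
      (∀ j → IsFlat C (A j))
      × (∀ i → A (inject₁ i) ⊂ A (fsuc i))
      × IsTransversal X k A

IsSimple : Complex → Set
IsSimple C =
  ∀ p q X → (∀ v → v ∈ X → (v ≡ p) ⊎ (v ≡ q)) → H C X

record ComplexIso (C D : Complex) : Set where
  field
    φ : V C ↔ V D
    preserves : ∀ X → H C X ⇔ H D (λ w → X (Inverse.from φ w))

private
  guard : (b : Bool) → (T b → Bool) → Bool
  guard true  f = f tt
  guard false _ = false

extend : {V : Set} (W : Subset V) → Subset (Σ V (λ v → T (W v))) → Subset V
extend W Y v = guard (W v) (λ t → Y (v , t))

restrict : (C : Complex) → Subset (V C) → Complex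
restrict C W = record
  { V = Σ (V C) (λ v → T (W v))
  ; H = λ Y → H C (extend W Y)
  }

allᵇ : {A : Set} → (A → Bool) → List A → Bool
allᵇ p = foldr (λ a acc → p a ∧ acc) true

record FinLattice : Set₁ where
  field
    n    : ℕ
    _≤ᵇ_ : Fin n → Fin n → Bool
    _⊔_  : Fin n → Fin n → Fin n
    _⊓_  : Fin n → Fin n → Fin n
    top  : Fin n
    bot  : Fin n
  _≤_ : Fin n → Fin n → Set
  x ≤ y = T (x ≤ᵇ y)
  _<_ : Fin n → Fin n → Set
  x < y = x ≤ y × ¬ (x ≡ y)
  field
    isBoundedLattice : LS.IsBoundedLattice _≡_ _≤_ _⊔_ _⊓_ top bot

module _ (L : FinLattice) where
  open FinLattice L

  isAtom : Fin n → Bool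
  isAtom a = not ⌊ a ≟ᶠ bot ⌋
             ∧ allᵇ (λ z → not (z ≤ᵇ a) ∨ ⌊ z ≟ᶠ bot ⌋ ∨ ⌊ z ≟ᶠ a ⌋) (allFin n)

  At : Set
  At = Σ (Fin n) (λ a → T (isAtom a))

  ⋁ : Subset (Fin n) → Fin n
  ⋁ S = foldr (λ i acc → if S i then i ⊔ acc else acc) bot (allFin n)

  ⋁At : Subset At → Fin n
  ⋁At F = ⋁ (extend isAtom F)

  Atomistic : Set
  Atomistic = ∀ x → Σ[ S ∈ Subset At ] ⋁At S ≡ x

  ξ : Fin n → Subset At
  ξ x a = proj₁ a ≤ᵇ x

  𝒯 : Complex
  𝒯 = record
    { V = At
    ; H = λ X → Σ[ m ∈ ℕ ] Σ[ c ∈ (Fin (suc m) → Fin n) ]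
                  (∀ i → c (inject₁ i) < c (fsuc i))
                  × IsTransversal X m (λ j → ξ (c j))
    }

record LatIso (L : FinLattice) (C : Complex) : Set where
  open FinLattice L
  field
    to      : Fin n → Subset (V C)
    to-flat : ∀ x → IsFlat C (to x)
    from    : (F : Subset (V C)) → IsFlat C F → Fin n
    from-to : ∀ x p → from (to x) p ≡ x
    to-from : ∀ F p → to (from F p) ≐ F
    to-mono : ∀ x y → x ≤ y → to x ⊆ to y
    to-refl : ∀ x y → to x ⊆ to y → x ≤ y

ξ-Onto : FinLattice → Set
ξ-Onto L = ∀ F → IsFlat (𝒯 L) F → Σ[ x ∈ Fin (FinLattice.n L) ] ξ L x ≐ F

CondIV : FinLattice → Set
CondIV L = ∀ F → IsFlat (𝒯 L) F → ξ L (⋁At L F) ⊆ F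

-- ξ is an order embedding of the atomistic lattice L into Fl 𝒯_L (x is the join of xξ), so (ii),
-- (iii) and (iv) all say that ξ is onto, L being finite; and 𝒯_L, whose faces are the transversals
-- of chains of flats xξ, is itself boolean representable, giving (ii) ⇒ (i).
--
-- Conversely let ψ : L ≅ Fl 𝓗 with 𝓗 boolean representable. The closure cl v of a vertex, the
-- least element of L whose flat contains v, is an atom unless v is a loop. Mapping the chain of
-- flats that witnesses a face X of 𝓗 into L shows that cl[X] is a face of 𝒯_L and that cl is
-- injective on X; since transversals of chains of flats are always faces, the converse holds
-- for sets of non-loops on which cl is injective. So for a flat F of 𝒯_L the vertices with
-- closure ⊥ or in F form a flat of 𝓗, whose element x of L satisfies xξ = F. One vertex per atom
-- gives a restriction of 𝓗 isomorphic to 𝒯_L; if 𝓗 is simple, cl is already a bijection onto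
-- the atoms.

module Submission where

open import Defs
open import Data.Product using (Σ; Σ-syntax; _×_)
open import Function.Bundles using (_⇔_)

open import Data.Bool using (Bool; true; false; T; not; _∧_; _∨_; if_then_else_)
open import Data.Bool.Properties using (T-irrelevant; T-∧; T-∨)
open import Data.Empty using (⊥-elim)
open import Data.Fin as Fin using (Fin; zero; suc; inject₁; fromℕ; toℕ)
import Data.Fin.Properties as Finₚ
open import Data.Fin.Relation.Unary.Top using (view; ‵fromℕ; ‵inj₁)
open import Data.List using (List; []; _∷_; foldr; allFin)
open import Data.List.Membership.Propositional using () renaming (_∈_ to _∈ˡ_)
open import Data.List.Membership.Propositional.Properties using (∈-allFin)
open import Data.List.Relation.Unary.Any using (here; there)
open import Data.Nat as ℕ using (ℕ; zero; suc; z≤n; s≤s)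
import Data.Nat.Properties as ℕₚ
open import Data.Product using (∃; ∃-syntax; _,_; proj₁; proj₂)
open import Data.Sum using (_⊎_; inj₁; inj₂; map; map₁; swap)
open import Data.Unit using (⊤; tt)
open import Data.Vec.Functional using () renaming (_∷_ to _∷ᶠ_)
open import Function.Base using (_∘_)
open import Function.Bundles using (_↔_; Inverse; mk⇔; mk↔ₛ′; module Equivalence)
open import Function.Definitions using (Injective)
import Relation.Binary.Lattice.Structures as LS
open import Relation.Binary.Definitions using (DecidableEquality; tri<; tri≈; tri>)
open import Relation.Binary.PropositionalEquality using (_≡_; _≢_; refl; sym; trans; cong; subst)
open import Relation.Nullary using (¬_; Dec; yes; no)
open import Relation.Nullary.Decidable
  using (⌊_⌋; map′; _×-dec_; T?; toWitness; fromWitness; toWitnessFalse; fromWitnessFalse)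

open Equivalence using () renaming (to to fwd; from to bwd)

ΣT-≡ : {A : Set} {P : A → Bool} {a b : A} {p : T (P a)} {q : T (P b)} →
       a ≡ b → _≡_ {A = Σ A (T ∘ P)} (a , p) (b , q)
ΣT-≡ {p = p} {q} refl = cong (_ ,_) (T-irrelevant p q)

module _ {V : Set} where

  ⊆-trans : {X Y Z : Subset V} → X ⊆ Y → Y ⊆ Z → X ⊆ Z
  ⊆-trans X⊆Y Y⊆Z v = Y⊆Z v ∘ X⊆Y v

  ≐-sym : {X Y : Subset V} → X ≐ Y → Y ≐ X
  ≐-sym (X⊆Y , Y⊆X) = Y⊆X , X⊆Y

  ≐-trans : {X Y Z : Subset V} → X ≐ Y → Y ≐ Z → X ≐ Z
  ≐-trans (X⊆Y , Y⊆X) (Y⊆Z , Z⊆Y) = ⊆-trans X⊆Y Y⊆Z , ⊆-trans Z⊆Y Y⊆X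

  -- extend guards with a private function of Defs; instantiated at ⊤ it can be evaluated by
  -- case analysis on the guarding Boolean.
  ∈-extend : (W : Subset V) (Y : Subset (Σ V (T ∘ W))) {v : V} (w : v ∈ W) →
             v ∈ extend W Y ⇔ (v , w) ∈ Y
  ∈-extend W Y {v} = guard⇔ (W v) (λ w → Y (v , w))
    where
    guard⇔ : (b : Bool) (g : T b → Bool) (t : T b) →
             T (extend {⊤} (λ _ → b) (g ∘ proj₂) tt) ⇔ T (g t)
    guard⇔ true g _ = mk⇔ (λ y → y) (λ y → y)

  extend-⊆ : (W : Subset V) (Y : Subset (Σ V (T ∘ W))) → extend W Y ⊆ W
  extend-⊆ W Y v = guard⊆ (W v) (λ w → Y (v , w))
    where
    guard⊆ : (b : Bool) (g : T b → Bool) → T (extend {⊤} (λ _ → b) (g ∘ proj₂) tt) → T b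
    guard⊆ true _ _ = _

  infix 4 _enumerates_
  _enumerates_ : {k : ℕ} → (Fin k → V) → Subset V → Set
  x enumerates X = ∀ v → (v ∈ X) ⇔ (∃[ i ] x i ≡ v)

snoc : {A : Set} {k : ℕ} → (Fin k → A) → A → Fin (suc k) → A
snoc {k = zero}  f a zero    = a
snoc {k = suc k} f a zero    = f zero
snoc {k = suc k} f a (suc i) = snoc (f ∘ suc) a i

snoc-inject₁ : {A : Set} {k : ℕ} (f : Fin k → A) (a : A) (i : Fin k) → snoc f a (inject₁ i) ≡ f i
snoc-inject₁ f a zero    = refl
snoc-inject₁ f a (suc i) = snoc-inject₁ (f ∘ suc) a i

snoc-last : {A : Set} {k : ℕ} (f : Fin k → A) (a : A) → snoc f a (fromℕ k) ≡ a
snoc-last {k = zero}  f a = refl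
snoc-last {k = suc k} f a = snoc-last (f ∘ suc) a

module _ {V : Set} where

  ∃-snoc : {k : ℕ} (x : Fin (suc k) → V) (v : V) →
           (∃[ i ] x i ≡ v) ⇔ ((∃[ j ] x (inject₁ j) ≡ v) ⊎ v ≡ x (fromℕ k))
  ∃-snoc x v = mk⇔ split (λ { (inj₁ (j , eq)) → inject₁ j , eq ; (inj₂ eq) → fromℕ _ , sym eq })
    where
    split : ∃[ i ] x i ≡ v → (∃[ j ] x (inject₁ j) ≡ v) ⊎ v ≡ x (fromℕ _)
    split (i , eq) with view i
    ... | ‵fromℕ    = inj₂ (sym eq)
    ... | ‵inj₁ {i = j} _ = inj₁ (j , eq)

  snoc-enumerates : {k : ℕ} {x : Fin k → V} {I J : Subset V} {p : V} → x enumerates I →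
                    (∀ v → (v ∈ J) ⇔ ((v ∈ I) ⊎ (v ≡ p))) → snoc x p enumerates J
  snoc-enumerates {k} {x} {I} {J} {p} enum J⇔ v = mk⇔ into onto
    where
    into : v ∈ J → ∃[ i ] snoc x p i ≡ v
    into v∈J with fwd (J⇔ v) v∈J
    ... | inj₁ v∈I  = let (j , eq) = fwd (enum v) v∈I in inject₁ j , trans (snoc-inject₁ x p j) eq
    ... | inj₂ refl = fromℕ k , snoc-last x p
    onto : ∃[ i ] snoc x p i ≡ v → v ∈ J
    onto hit with fwd (∃-snoc (snoc x p) v) hit
    ... | inj₁ (j , eq) = bwd (J⇔ v) (inj₁ (bwd (enum v) (j , trans (sym (snoc-inject₁ x p j)) eq)))
    ... | inj₂ eq       = bwd (J⇔ v) (inj₂ (trans eq (snoc-last x p)))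

module _ {V : Set} (fin : Finite V) where
  private
    ι = proj₂ fin

  finite-≟ : DecidableEquality V
  finite-≟ u v = map′ to-injective (cong (Inverse.to ι)) (Inverse.to ι u Fin.≟ Inverse.to ι v)
    where
    to-injective : Inverse.to ι u ≡ Inverse.to ι v → u ≡ v
    to-injective eq = trans (sym (Inverse.strictlyInverseʳ ι u))
                            (trans (cong (Inverse.from ι) eq) (Inverse.strictlyInverseʳ ι v))

  finite-any? : {P : V → Set} → (∀ v → Dec (P v)) → Dec (∃ P)
  finite-any? {P} P? = map′ (λ (j , p) → Inverse.from ι j , p)
                            (λ (v , p) → Inverse.to ι v , subst P (sym (Inverse.strictlyInverseʳ ι v)) p)
                            (Finₚ.any? (P? ∘ Inverse.from ι))

injective⇒surjective : {n : ℕ} (f : Fin n → Fin n) → Injective _≡_ _≡_ f → ∀ y → ∃[ x ] f x ≡ y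
injective⇒surjective {zero}  f inj ()
injective⇒surjective {suc n} f inj y with Finₚ.any? (λ x → f x Fin.≟ y)
... | yes hit = hit
... | no miss = ⊥-elim (ℕₚ.1+n≰n (Finₚ.injective⇒≤ punchedOut-injective))
  where
  punchedOut : Fin (suc n) → Fin n
  punchedOut x = Fin.punchOut {i = y} (λ eq → miss (x , sym eq))
  punchedOut-injective : Injective _≡_ _≡_ punchedOut
  punchedOut-injective {a} {b} eq =
    inj (Finₚ.punchOut-injective {i = y} (λ e → miss (a , sym e)) (λ e → miss (b , sym e)) eq)

ΣT-finite : (n : ℕ) (P : Fin n → Bool) → Finite (Σ (Fin n) (T ∘ P))
ΣT-finite zero    P = zero , mk↔ₛ′ (λ ()) (λ ()) (λ ()) (λ ())
ΣT-finite (suc n) P with ΣT-finite n (P ∘ suc) | P zero in P0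
... | k , ι | true  = suc k , mk↔ₛ′ to from to-from from-to
  where
  to : Σ (Fin (suc n)) (T ∘ P) → Fin (suc k)
  to (zero  , _) = zero
  to (suc i , t) = suc (Inverse.to ι (i , t))
  from : Fin (suc k) → Σ (Fin (suc n)) (T ∘ P)
  from zero    = zero , subst T (sym P0) _
  from (suc j) = let (i , t) = Inverse.from ι j in suc i , t
  to-from : ∀ j → to (from j) ≡ j
  to-from zero    = refl
  to-from (suc j) = cong suc (Inverse.strictlyInverseˡ ι j)
  from-to : ∀ x → from (to x) ≡ x
  from-to (zero  , _) = ΣT-≡ {P = P} refl
  from-to (suc i , t) = ΣT-≡ {P = P} (cong (suc ∘ proj₁) (Inverse.strictlyInverseʳ ι (i , t)))
... | k , ι | false = k , mk↔ₛ′ to from (Inverse.strictlyInverseˡ ι) from-to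
  where
  to : Σ (Fin (suc n)) (T ∘ P) → Fin k
  to (zero  , t) = ⊥-elim (subst T P0 t)
  to (suc i , t) = Inverse.to ι (i , t)
  from : Fin k → Σ (Fin (suc n)) (T ∘ P)
  from j = let (i , t) = Inverse.from ι j in suc i , t
  from-to : ∀ x → from (to x) ≡ x
  from-to (zero  , t) = ⊥-elim (subst T P0 t)
  from-to (suc i , t) = ΣT-≡ {P = P} (cong (suc ∘ proj₁) (Inverse.strictlyInverseʳ ι (i , t)))

module Chains {B : Set} (_≼_ : B → B → Set)
              (≼-refl : ∀ {b} → b ≼ b) (≼-trans : ∀ {a b c} → a ≼ b → b ≼ c → a ≼ c)
              {V : Set} (_∈ᶜ_ : V → B → Set)
              (∈ᶜ-mono : ∀ {v a b} → v ∈ᶜ a → a ≼ b → v ∈ᶜ b) where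

  IsChain : {m : ℕ} → (Fin (suc m) → B) → Set
  IsChain {m} A = ∀ (i : Fin m) → A (inject₁ i) ≼ A (suc i)

  Transversal : {m : ℕ} → (Fin m → V) → (Fin (suc m) → B) → Set
  Transversal {m} x A = ∀ (i : Fin m) → (x i ∈ᶜ A (suc i)) × ¬ (x i ∈ᶜ A (inject₁ i))

  chain-mono : {m : ℕ} (A : Fin (suc m) → B) → IsChain A → ∀ i j → toℕ i ℕ.≤ toℕ j → A i ≼ A j
  chain-mono         A ch zero    zero    _         = ≼-refl
  chain-mono {suc m} A ch zero    (suc j) _         =
    ≼-trans (ch zero) (chain-mono (A ∘ suc) (ch ∘ suc) zero j z≤n)
  chain-mono {suc m} A ch (suc i) (suc j) (s≤s i≤j) = chain-mono (A ∘ suc) (ch ∘ suc) i j i≤j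

  transversal-separated : {m : ℕ} (A : Fin (suc m) → B) {x : Fin m → V} →
                          IsChain A → Transversal x A → ∀ {i j} → i Fin.< j → x i ≢ x j
  transversal-separated A {x} ch tr {i} {j} i<j eq =
    proj₂ (tr j) (subst (_∈ᶜ A (inject₁ j)) eq
                        (∈ᶜ-mono (proj₁ (tr i)) (chain-mono A ch (suc i) (inject₁ j) i<j′)))
    where
    i<j′ : suc (toℕ i) ℕ.≤ toℕ (inject₁ j)
    i<j′ = subst (suc (toℕ i) ℕ.≤_) (sym (Finₚ.toℕ-inject₁ j)) i<j

  transversal-injective : {m : ℕ} (A : Fin (suc m) → B) {x : Fin m → V} →
                          IsChain A → Transversal x A → Injective _≡_ _≡_ x
  transversal-injective A ch tr {i} {j} eq with Finₚ.<-cmp i j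
  ... | tri< i<j _ _ = ⊥-elim (transversal-separated A ch tr i<j eq)
  ... | tri≈ _ i≡j _ = i≡j
  ... | tri> _ _ j<i = ⊥-elim (transversal-separated A ch tr j<i (sym eq))

  transversal-snoc : {m : ℕ} (A : Fin (suc m) → B) (x : Fin m → V) {b : B} {v : V} →
                     IsChain A → Transversal x A →
                     A (fromℕ m) ≼ b → v ∈ᶜ b → ¬ (v ∈ᶜ A (fromℕ m)) →
                     IsChain (snoc A b) × Transversal (snoc x v) (snoc A b)
  transversal-snoc {m} A x {b} {v} ch tr top≼b v∈b v∉top = chain , transversal
    where
    chain : IsChain (snoc A b)
    chain i with view i
    ... | ‵fromℕ rewrite snoc-inject₁ A b (fromℕ m) | snoc-last A b = top≼b
    ... | ‵inj₁ {i = j} _ rewrite snoc-inject₁ A b (inject₁ j) | snoc-inject₁ A b (suc j) = ch j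
    transversal : Transversal (snoc x v) (snoc A b)
    transversal i with view i
    ... | ‵fromℕ rewrite snoc-last x v | snoc-inject₁ A b (fromℕ m) | snoc-last A b = v∈b , v∉top
    ... | ‵inj₁ {i = j} _
      rewrite snoc-inject₁ x v j | snoc-inject₁ A b (inject₁ j) | snoc-inject₁ A b (suc j) = tr j

  record Selection {m : ℕ} (A : Fin (suc m) → B) (x : Fin m → V) (S : Subset V) : Set where
    field
      k           : ℕ
      A′          : Fin (suc k) → B
      x′          : Fin k → V
      chain       : IsChain A′
      transversal : Transversal x′ A′
      base        : A zero ≼ A′ zero
      selects     : ∀ v → (∃[ i ] x′ i ≡ v) ⇔ ((∃[ i ] x i ≡ v) × v ∈ S)

  transversal-select : {m : ℕ} (A : Fin (suc m) → B) (x : Fin m → V) → IsChain A → Transversal x A →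
                       (S : Subset V) → Selection A x S
  transversal-select {zero} A x ch tr S = record
    { k = zero ; A′ = A ; x′ = x ; chain = λ () ; transversal = λ () ; base = ≼-refl
    ; selects = λ v → mk⇔ (λ { (() , _) }) (λ { ((() , _) , _) }) }
  transversal-select {suc m} A x ch tr S with transversal-select (A ∘ suc) (x ∘ suc) (ch ∘ suc) (tr ∘ suc) S
                                            | S (x zero) in x₀∈?S
  ... | sel | false = record
    { k = k ; A′ = A′ ; x′ = x′ ; chain = chain ; transversal = transversal
    ; base = ≼-trans (ch zero) base
    ; selects = λ v → mk⇔ (λ hit → let ((i , eq) , v∈S) = fwd (selects v) hit in (suc i , eq) , v∈S)
                          (λ { ((zero , refl) , v∈S) → ⊥-elim (subst T x₀∈?S v∈S)
                             ; ((suc i , eq) , v∈S) → bwd (selects v) ((i , eq) , v∈S) }) }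
    where open Selection sel
  ... | sel | true = record
    { k = suc k ; A′ = A zero ∷ᶠ A′ ; x′ = x zero ∷ᶠ x′
    ; chain = chain′ ; transversal = transversal′ ; base = ≼-refl ; selects = selects′ }
    where
    open Selection sel
    chain′ : IsChain (A zero ∷ᶠ A′)
    chain′ zero    = ≼-trans (ch zero) base
    chain′ (suc i) = chain i
    transversal′ : Transversal (x zero ∷ᶠ x′) (A zero ∷ᶠ A′)
    transversal′ zero    = ∈ᶜ-mono (proj₁ (tr zero)) base , proj₂ (tr zero)
    transversal′ (suc i) = transversal i
    selects′ : ∀ v → (∃[ i ] (x zero ∷ᶠ x′) i ≡ v) ⇔ ((∃[ i ] x i ≡ v) × v ∈ S)
    selects′ v = mk⇔ into onto
      where
      into : ∃[ i ] (x zero ∷ᶠ x′) i ≡ v → (∃[ i ] x i ≡ v) × v ∈ S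
      into (zero  , refl) = (zero , refl) , subst T (sym x₀∈?S) _
      into (suc i , eq)   = let ((j , eq′) , v∈S) = fwd (selects v) (i , eq) in (suc j , eq′) , v∈S
      onto : (∃[ i ] x i ≡ v) × v ∈ S → ∃[ i ] (x zero ∷ᶠ x′) i ≡ v
      onto ((zero  , eq) , _)   = zero , eq
      onto ((suc j , eq) , v∈S) = let (i , eq′) = bwd (selects v) ((j , eq) , v∈S) in suc i , eq′

module SubsetChains {V : Set} =
  Chains {Subset V} _⊆_ (λ _ v∈X → v∈X) ⊆-trans {V} _∈_ (λ v∈X X⊆Y → X⊆Y _ v∈X)

module _ (C : Complex) where

  ∩-isFlat : {X Y : Subset (V C)} → IsFlat C X → IsFlat C Y → IsFlat C (λ v → X v ∧ Y v)
  ∩-isFlat {X} {Y} X-flat Y-flat I I-face I⊆X∩Y p p∉X∩Y with X p in p∈?X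
  ... | false = X-flat I I-face (λ v → proj₁ ∘ fwd T-∧ ∘ I⊆X∩Y v) p (λ p∈X → subst T p∈?X p∈X)
  ... | true  = Y-flat I I-face (λ v → proj₂ ∘ fwd (T-∧ {X v}) ∘ I⊆X∩Y v) p p∉X∩Y

  full-isFlat : IsFlat C (λ _ → true)
  full-isFlat I _ _ p p∉full = ⊥-elim (p∉full _)

module _ (C : Complex) (sc : IsSimplicialComplex C) where
  private
    _≟_ = finite-≟ (proj₁ sc)
    open SubsetChains {V C}

  face-⊆-closed : {X Y : Subset (V C)} → X ⊆ Y → H C Y → H C X
  face-⊆-closed = proj₂ (proj₂ (proj₂ sc)) _ _

  empty-isFace : H C (λ _ → false)
  empty-isFace = let (X , X-face) = proj₁ (proj₂ (proj₂ sc)) in face-⊆-closed (λ _ ()) X-face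

  range : {k : ℕ} → (Fin k → V C) → Subset (V C)
  range u v = ⌊ Finₚ.any? (λ i → u i ≟ v) ⌋

  ∈-range : {k : ℕ} (u : Fin k → V C) {v : V C} → v ∈ range u ⇔ (∃[ i ] u i ≡ v)
  ∈-range u = mk⇔ toWitness fromWitness

  range-isFace : (k : ℕ) (A : Fin (suc k) → Subset (V C)) (u : Fin k → V C) →
                 (∀ j → IsFlat C (A j)) → IsChain A → Transversal u A → H C (range u)
  range-isFace zero A u flats ch tr =
    face-⊆-closed (λ v v∈ → ⊥-elim (Finₚ.¬Fin0 (proj₁ (fwd (∈-range u {v}) v∈)))) empty-isFace
  range-isFace (suc k) A u flats ch tr =
    flats (inject₁ (fromℕ k)) (range u′) previous-isFace previous⊆top
          (u (fromℕ k)) (proj₂ (tr (fromℕ k))) (range u) range-snoc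
    where
    u′ : Fin k → V C
    u′ = u ∘ inject₁
    previous-isFace : H C (range u′)
    previous-isFace = range-isFace k (A ∘ inject₁) u′ (flats ∘ inject₁) (ch ∘ inject₁) (tr ∘ inject₁)
    below-top : ∀ i → toℕ (suc (inject₁ i)) ℕ.≤ toℕ (inject₁ (fromℕ k))
    below-top i rewrite Finₚ.toℕ-inject₁ i | Finₚ.toℕ-inject₁ (fromℕ k) | Finₚ.toℕ-fromℕ k =
      Finₚ.toℕ<n i
    previous⊆top : range u′ ⊆ A (inject₁ (fromℕ k))
    previous⊆top v v∈ with fwd (∈-range u′) v∈
    ... | i , refl =
      chain-mono A ch (suc (inject₁ i)) (inject₁ (fromℕ k)) (below-top i) (u′ i) (proj₁ (tr (inject₁ i)))
    range-snoc : ∀ v → (v ∈ range u) ⇔ ((v ∈ range u′) ⊎ (v ≡ u (fromℕ k)))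
    range-snoc v = mk⇔ (λ v∈ → map₁ (bwd (∈-range u′)) (fwd (∃-snoc u v) (fwd (∈-range u) v∈)))
                       (λ h → bwd (∈-range u) (bwd (∃-snoc u v) (map₁ (fwd (∈-range u′)) h)))

  transversal-isFace : {k : ℕ} {A : Fin (suc k) → Subset (V C)} {X : Subset (V C)} →
                       (∀ j → IsFlat C (A j)) → IsChain A → IsTransversal X k A → H C X
  transversal-isFace {k} {A} flats ch (u , _ , enum , tr) =
    face-⊆-closed (λ v v∈X → bwd (∈-range u) (fwd (enum v) v∈X)) (range-isFace k A u flats ch tr)

T-not : {b : Bool} → T (not b) ⇔ (¬ T b)
T-not {true}  = mk⇔ (λ ()) (λ ¬t → ¬t _)
T-not {false} = mk⇔ (λ _ ()) (λ _ → _)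

T-allᵇ : {A : Set} (p : A → Bool) (xs : List A) → T (allᵇ p xs) ⇔ (∀ x → x ∈ˡ xs → T (p x))
T-allᵇ p []       = mk⇔ (λ _ _ ()) (λ _ → _)
T-allᵇ p (y ∷ xs) = mk⇔
  (λ h → let (py , pxs) = fwd T-∧ h in
         λ { x (here refl) → py ; x (there x∈) → fwd (T-allᵇ p xs) pxs x x∈ })
  (λ h → bwd T-∧ (h y (here refl) , bwd (T-allᵇ p xs) (λ x → h x ∘ there)))

module LatticeFacts (L : FinLattice) where
  open FinLattice L public
  open LS.IsBoundedLattice isBoundedLattice public
    using (x≤x∨y; y≤x∨y; ∨-least; x∧y≤x; x∧y≤y; ∧-greatest; maximum; minimum)
    renaming (refl to ≤-refl; trans to ≤-trans; antisym to ≤-antisym; reflexive to ≤-reflexive)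

  ⋁-upper : (S : Subset (Fin n)) {i : Fin n} → i ∈ S → i ≤ ⋁ L S
  ⋁-upper S {i} = go (allFin n) (∈-allFin i)
    where
    go : ∀ xs → i ∈ˡ xs → i ∈ S → i ≤ foldr (λ j acc → if S j then j ⊔ acc else acc) bot xs
    go (j ∷ xs) (here refl) i∈S with S j
    ... | true = x≤x∨y _ _
    go (j ∷ xs) (there i∈) i∈S with S j
    ... | true  = ≤-trans (go xs i∈ i∈S) (y≤x∨y _ _)
    ... | false = go xs i∈ i∈S

  ⋁-least : (S : Subset (Fin n)) {y : Fin n} → (∀ i → i ∈ S → i ≤ y) → ⋁ L S ≤ y
  ⋁-least S {y} bound = go (allFin n)
    where
    go : ∀ xs → foldr (λ j acc → if S j then j ⊔ acc else acc) bot xs ≤ y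
    go []       = minimum y
    go (j ∷ xs) with S j in j∈?S
    ... | true  = ∨-least (bound j (subst T (sym j∈?S) _)) (go xs)
    ... | false = go xs

  ⋁At-upper : (F : Subset (At L)) {a : At L} → a ∈ F → proj₁ a ≤ ⋁At L F
  ⋁At-upper F {_ , t} a∈F = ⋁-upper (extend (isAtom L) F) (bwd (∈-extend (isAtom L) F t) a∈F)

  ⋁At-least : (F : Subset (At L)) {y : Fin n} → (∀ a → a ∈ F → proj₁ a ≤ y) → ⋁At L F ≤ y
  ⋁At-least F bound =
    ⋁-least _ (λ i i∈ → let t = extend-⊆ (isAtom L) F i i∈ in
                         bound (i , t) (fwd (∈-extend (isAtom L) F t) i∈))

  ⋀ : Subset (Fin n) → Fin n
  ⋀ S = foldr (λ i acc → if S i then i ⊓ acc else acc) top (allFin n)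

  ⋀-lower : (S : Subset (Fin n)) {i : Fin n} → i ∈ S → ⋀ S ≤ i
  ⋀-lower S {i} = go (allFin n) (∈-allFin i)
    where
    go : ∀ xs → i ∈ˡ xs → i ∈ S → foldr (λ j acc → if S j then j ⊓ acc else acc) top xs ≤ i
    go (j ∷ xs) (here refl) i∈S with S j
    ... | true = x∧y≤x _ _
    go (j ∷ xs) (there i∈) i∈S with S j
    ... | true  = ≤-trans (x∧y≤y _ _) (go xs i∈ i∈S)
    ... | false = go xs i∈ i∈S

  ⋀-closed : (P : Fin n → Set) → P top → (∀ {x y} → P x → P y → P (x ⊓ y)) →
             (S : Subset (Fin n)) → (∀ i → i ∈ S → P i) → P (⋀ S)
  ⋀-closed P P-top P-⊓ S P-S = go (allFin n)
    where
    go : ∀ xs → P (foldr (λ j acc → if S j then j ⊓ acc else acc) top xs)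
    go []       = P-top
    go (j ∷ xs) with S j in j∈?S
    ... | true  = P-⊓ (P-S j (subst T (sym j∈?S) _)) (go xs)
    ... | false = go xs

  IsAtom : Fin n → Set
  IsAtom a = a ≢ bot × (∀ z → z ≤ a → (z ≡ bot) ⊎ (z ≡ a))

  isAtom⇔IsAtom : {a : Fin n} → T (isAtom L a) ⇔ IsAtom a
  isAtom⇔IsAtom {a} = mk⇔ into onto
    where
    is-bot? is-a? : Fin n → Bool
    is-bot? z = ⌊ z Finₚ.≟ bot ⌋
    is-a?   z = ⌊ z Finₚ.≟ a ⌋
    below? : Fin n → Bool
    below? z = not (z ≤ᵇ a) ∨ is-bot? z ∨ is-a? z
    below?⇔ : ∀ z → T (below? z) ⇔ (¬ (z ≤ a) ⊎ T (is-bot? z) ⊎ T (is-a? z))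
    below?⇔ z = mk⇔ (map (fwd T-not) (fwd T-∨) ∘ fwd (T-∨ {not (z ≤ᵇ a)}))
                    (bwd (T-∨ {not (z ≤ᵇ a)}) ∘ map (bwd T-not) (bwd T-∨))
    parts : T (isAtom L a) ⇔ (T (not (is-bot? a)) × T (allᵇ below? (allFin n)))
    parts = T-∧
    into : T (isAtom L a) → IsAtom a
    into h = toWitnessFalse a≢bot , below
      where
      a≢bot = proj₁ (fwd parts h)
      below : ∀ z → z ≤ a → (z ≡ bot) ⊎ (z ≡ a)
      below z z≤a with fwd (below?⇔ z) (fwd (T-allᵇ below? (allFin n)) (proj₂ (fwd parts h)) z (∈-allFin z))
      ... | inj₁ z≰a = ⊥-elim (z≰a z≤a)
      ... | inj₂ z≡  = map toWitness toWitness z≡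
    onto : IsAtom a → T (isAtom L a)
    onto (a≢bot , below) = bwd parts (fromWitnessFalse a≢bot , bwd (T-allᵇ below? (allFin n)) below-all)
      where
      below-all : ∀ z → z ∈ˡ allFin n → T (below? z)
      below-all z _ with T? (z ≤ᵇ a)
      ... | no  z≰a = bwd (below?⇔ z) (inj₁ z≰a)
      ... | yes z≤a = bwd (below?⇔ z) (inj₂ (map fromWitness fromWitness (below z z≤a)))

module TransversalComplex (L : FinLattice) where
  open LatticeFacts L
  open Chains _≤_ ≤-refl ≤-trans {At L} (λ a x → a ∈ ξ L x) ≤-trans public

  ξ-mono : {x y : Fin n} → x ≤ y → ξ L x ⊆ ξ L y
  ξ-mono x≤y a a≤x = ≤-trans a≤x x≤y

  𝒯-face : {m : ℕ} {X : Subset (At L)} (c : Fin (suc m) → Fin n) (e : Fin m → At L) →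
           IsChain c → Transversal e c → e enumerates X → H (𝒯 L) X
  𝒯-face {m} c e ch tr enum = m , c , strict , e , transversal-injective c ch tr , enum , tr
    where
    strict : ∀ i → c (inject₁ i) < c (suc i)
    strict i = ch i , λ c≡ → proj₂ (tr i) (subst (e i ∈_) (cong (ξ L) (sym c≡)) (proj₁ (tr i)))

  ξ-isFlat : ∀ x → IsFlat (𝒯 L) (ξ L x)
  ξ-isFlat x I (m , c , strict , e , _ , enum , tr) I⊆ξx p p∉ξx J J⇔ =
    𝒯-face (snoc cx (x ⊔ proj₁ p)) (snoc e p) (proj₁ extended) (proj₂ extended) (snoc-enumerates enum J⇔)
    where
    cx : Fin (suc m) → Fin n
    cx j = c j ⊓ x
    cx-chain : IsChain cx
    cx-chain i = ∧-greatest (≤-trans (x∧y≤x _ _) (proj₁ (strict i))) (x∧y≤y _ _)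
    cx-transversal : Transversal e cx
    cx-transversal i = ∧-greatest (proj₁ (tr i)) (I⊆ξx (e i) (bwd (enum (e i)) (i , refl)))
                     , λ e≤cx → proj₂ (tr i) (≤-trans e≤cx (x∧y≤x _ _))
    extended = transversal-snoc cx e cx-chain cx-transversal (≤-trans (x∧y≤y _ _) (x≤x∨y _ _))
                 (y≤x∨y _ _) (λ p≤cx → p∉ξx (≤-trans p≤cx (x∧y≤y _ _)))

  𝒯-⊆-closed : {X Y : Subset (At L)} → X ⊆ Y → H (𝒯 L) Y → H (𝒯 L) X
  𝒯-⊆-closed {X} X⊆Y (m , c , strict , e , _ , enum , tr) =
    𝒯-face A′ x′ chain transversal λ a → mk⇔
      (λ a∈X → bwd (selects a) (fwd (enum a) (X⊆Y a a∈X) , a∈X))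
      (λ hit → proj₂ (fwd (selects a) hit))
    where open Selection (transversal-select c e (proj₁ ∘ strict) tr X)

  𝒯-booleanRepresentable : BooleanRepresentable (𝒯 L)
  𝒯-booleanRepresentable X (m , c , strict , e , e-injective , enum , tr) =
    m , ξ L ∘ c , ξ-isFlat ∘ c , strict-inclusion , e , e-injective , enum , tr
    where
    strict-inclusion : ∀ i → ξ L (c (inject₁ i)) ⊂ ξ L (c (suc i))
    strict-inclusion i = ξ-mono (proj₁ (strict i)) , λ ⊇ → proj₂ (tr i) (⊇ (e i) (proj₁ (tr i)))

  𝒯-isSimplicialComplex : At L → IsSimplicialComplex (𝒯 L)
  𝒯-isSimplicialComplex a =
    ΣT-finite n (isAtom L) , a , ((λ _ → false) , empty-face) , λ _ _ → 𝒯-⊆-closed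
    where
    empty-face : H (𝒯 L) (λ _ → false)
    empty-face = 𝒯-face {zero} (λ _ → bot) (λ ()) (λ ()) (λ ()) (λ _ → mk⇔ (λ ()) λ { (() , _) })

module _ {L : FinLattice} {C : Complex} (ψ : LatIso L C) where
  open LatIso ψ

  from-mono : {F G : Subset (V C)} (F-flat : IsFlat C F) (G-flat : IsFlat C G) →
              F ⊆ G → FinLattice._≤_ L (from F F-flat) (from G G-flat)
  from-mono {F} {G} F-flat G-flat F⊆G =
    to-refl _ _ (⊆-trans (proj₁ (to-from F F-flat)) (⊆-trans F⊆G (proj₂ (to-from G G-flat))))

  from-≡⇒≐ : {F G : Subset (V C)} {F-flat : IsFlat C F} {G-flat : IsFlat C G} →
             from F F-flat ≡ from G G-flat → F ≐ G
  from-≡⇒≐ {F} {G} {F-flat} {G-flat} eq =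
    ≐-trans (≐-sym (to-from F F-flat)) (subst (λ z → to z ≐ G) (sym eq) (to-from G G-flat))

module AtomisticLattice (L : FinLattice) (atomistic : Atomistic L) where
  open LatticeFacts L
  open TransversalComplex L

  ⋁At-ξ : ∀ x → ⋁At L (ξ L x) ≡ x
  ⋁At-ξ x =
    ≤-antisym (⋁At-least (ξ L x) (λ _ a≤x → a≤x))
              (subst (_≤ ⋁At L (ξ L x)) ⋁S≡x (⋁At-least S (λ a a∈S → ⋁At-upper (ξ L x) {a} (below-x a∈S))))
    where
    S = proj₁ (atomistic x)
    ⋁S≡x = proj₂ (atomistic x)
    below-x : {a : At L} → a ∈ S → a ∈ ξ L x
    below-x {a} a∈S = subst (proj₁ a ≤_) ⋁S≡x (⋁At-upper S a∈S)

  ξ-reflects-≤ : {x y : Fin n} → ξ L x ⊆ ξ L y → x ≤ y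
  ξ-reflects-≤ {x} {y} ξx⊆ξy = subst (_≤ y) (⋁At-ξ x) (⋁At-least (ξ L x) ξx⊆ξy)

  ξ-injective : {x y : Fin n} → ξ L x ≐ ξ L y → x ≡ y
  ξ-injective (ξx⊆ξy , ξy⊆ξx) = ≤-antisym (ξ-reflects-≤ ξx⊆ξy) (ξ-reflects-≤ ξy⊆ξx)

  onto⇒condIV : ξ-Onto L → CondIV L
  onto⇒condIV onto F F-flat a a∈ = let (x , ξx⊆F , F⊆ξx) = onto F F-flat in
    ξx⊆F a (≤-trans a∈ (⋁At-least F F⊆ξx))

  condIV⇒onto : CondIV L → ξ-Onto L
  condIV⇒onto condIV F F-flat = ⋁At L F , condIV F F-flat , λ _ → ⋁At-upper F

  onto⇒iso : ξ-Onto L → LatIso L (𝒯 L)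
  onto⇒iso onto = record
    { to      = ξ L
    ; to-flat = ξ-isFlat
    ; from    = λ F _ → ⋁At L F
    ; from-to = λ x _ → ⋁At-ξ x
    ; to-from = λ F F-flat → onto⇒condIV onto F F-flat , λ _ → ⋁At-upper F
    ; to-mono = λ _ _ → ξ-mono
    ; to-refl = λ _ _ → ξ-reflects-≤
    }

  atomless⇒trivial : ¬ At L → ∀ x → x ≡ bot
  atomless⇒trivial no-atom x =
    let (S , ⋁S≡x) = atomistic x in
    ≤-antisym (subst (_≤ bot) ⋁S≡x (⋁At-least S (λ a _ → ⊥-elim (no-atom a)))) (minimum x)

  -- L and Fl 𝒯_L have the same (finite) size, so the injection x ↦ ψ⁻¹(xξ) of L is onto.
  iso⇒onto : LatIso L (𝒯 L) → ξ-Onto L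
  iso⇒onto ψ F F-flat =
    let (x , gx≡) = injective⇒surjective g g-injective (from F F-flat) in x , from-≡⇒≐ ψ gx≡
    where
    open LatIso ψ
    g : Fin n → Fin n
    g x = from (ξ L x) (ξ-isFlat x)
    g-injective : Injective _≡_ _≡_ g
    g-injective eq = ξ-injective (from-≡⇒≐ ψ eq)

module Representation (L : FinLattice) (C : Complex) (sc : IsSimplicialComplex C)
                      (br : BooleanRepresentable C) (ψ : LatIso L C) where
  open LatticeFacts L
  open TransversalComplex L
  open LatIso ψ

  private
    Vertex = V C
    _≟_ : DecidableEquality Vertex
    _≟_ = finite-≟ (proj₁ sc)
    module ClosureChains = Chains _≤_ ≤-refl ≤-trans {Fin n} _≤_ ≤-trans

  to-⊓ : {x y : Fin n} {v : Vertex} → v ∈ to x → v ∈ to y → v ∈ to (x ⊓ y)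
  to-⊓ {x} {y} {v} v∈x v∈y =
    to-mono m (x ⊓ y) (∧-greatest m≤x m≤y) v (proj₂ (to-from _ ∩-flat) v (bwd T-∧ (v∈x , v∈y)))
    where
    ∩-flat = ∩-isFlat C (to-flat x) (to-flat y)
    m = from _ ∩-flat
    m≤x : m ≤ x
    m≤x = to-refl m x (λ q q∈m → proj₁ (fwd T-∧ (proj₁ (to-from _ ∩-flat) q q∈m)))
    m≤y : m ≤ y
    m≤y = to-refl m y (λ q q∈m → proj₂ (fwd (T-∧ {to x q}) (proj₁ (to-from _ ∩-flat) q q∈m)))

  to-top : (v : Vertex) → v ∈ to top
  to-top v = to-mono _ top (maximum _) v (proj₂ (to-from _ (full-isFlat C)) v _)

  cl : Vertex → Fin n
  cl v = ⋀ (λ x → to x v)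

  cl-∈ : (v : Vertex) → v ∈ to (cl v)
  cl-∈ v = ⋀-closed (λ x → v ∈ to x) (to-top v) to-⊓ _ (λ _ v∈x → v∈x)

  cl-least : {v : Vertex} {x : Fin n} → v ∈ to x → cl v ≤ x
  cl-least = ⋀-lower _

  ∈to⇔cl≤ : {v : Vertex} {x : Fin n} → v ∈ to x ⇔ cl v ≤ x
  ∈to⇔cl≤ {v} = mk⇔ cl-least (λ cl≤x → to-mono _ _ cl≤x v (cl-∈ v))

  ∈flat⇔cl≤ : (F : Subset Vertex) (F-flat : IsFlat C F) {v : Vertex} → v ∈ F ⇔ cl v ≤ from F F-flat
  ∈flat⇔cl≤ F F-flat {v} = mk⇔ (λ v∈F → cl-least (proj₂ (to-from F F-flat) v v∈F))
                                 (λ cl≤ → proj₁ (to-from F F-flat) v (bwd ∈to⇔cl≤ cl≤))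

  Nonloop : Vertex → Set
  Nonloop v = cl v ≢ bot

  record FaceChain (X : Subset Vertex) : Set where
    field
      k           : ℕ
      ℓ           : Fin (suc k) → Fin n
      x           : Fin k → Vertex
      chain       : ClosureChains.IsChain ℓ
      transversal : ClosureChains.Transversal (cl ∘ x) ℓ
      x-enumerates : x enumerates X

  faceChain : {X : Subset Vertex} → H C X → FaceChain X
  faceChain X-face with br _ X-face
  ... | k , A , flats , strict , x , _ , enum , tr = record
    { k           = k
    ; ℓ           = λ j → from (A j) (flats j)
    ; x           = x
    ; chain       = λ i → from-mono ψ (flats (inject₁ i)) (flats (suc i)) (proj₁ (strict i))
    ; transversal = λ i → fwd (∈flat⇔cl≤ _ (flats (suc i))) (proj₁ (tr i))
                        , proj₂ (tr i) ∘ bwd (∈flat⇔cl≤ _ (flats (inject₁ i)))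
    ; x-enumerates = enum
    }

  face-nonloop : {X : Subset Vertex} → H C X → {v : Vertex} → v ∈ X → Nonloop v
  face-nonloop X-face {v} v∈X cl≡bot =
    let (i , xi≡v) = fwd (x-enumerates v) v∈X
    in proj₂ (transversal i) (subst (_≤ ℓ (inject₁ i)) (sym (trans (cong cl xi≡v) cl≡bot)) (minimum _))
    where open FaceChain (faceChain X-face)

  face-cl-injective : {X : Subset Vertex} → H C X →
                      {u w : Vertex} → u ∈ X → w ∈ X → cl u ≡ cl w → u ≡ w
  face-cl-injective X-face {u} {w} u∈X w∈X cl≡ =
    let (i , xi≡u) = fwd (x-enumerates u) u∈X
        (j , xj≡w) = fwd (x-enumerates w) w∈X
        i≡j = ClosureChains.transversal-injective ℓ chain transversal
                (trans (cong cl xi≡u) (trans cl≡ (sym (cong cl xj≡w))))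
    in trans (sym xi≡u) (trans (cong x i≡j) xj≡w)
    where open FaceChain (faceChain X-face)

  single : Vertex → Subset Vertex
  single w v = ⌊ v ≟ w ⌋

  singleton-isFace : {w : Vertex} → Nonloop w → H C (single w)
  singleton-isFace {w} w-nonloop =
    to-flat bot (λ _ → false) (empty-isFace C sc) (λ _ ()) w w∉to-bot (single w)
      (λ v → mk⇔ (inj₂ ∘ toWitness) (λ { (inj₁ ()) ; (inj₂ v≡w) → fromWitness v≡w }))
    where
    w∉to-bot : ¬ (w ∈ to bot)
    w∉to-bot w∈ = w-nonloop (≤-antisym (cl-least w∈) (minimum _))

  pair-isFace : {u w : Vertex} {J : Subset Vertex} → Nonloop w → ¬ (cl u ≤ cl w) →
                (∀ v → (v ∈ J) ⇔ ((v ≡ w) ⊎ (v ≡ u))) → H C J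
  pair-isFace {u} {w} {J} w-nonloop cu≰cw J⇔ =
    to-flat (cl w) (single w) (singleton-isFace w-nonloop) single⊆ u (cu≰cw ∘ cl-least) J
      (λ v → mk⇔ (map₁ fromWitness ∘ fwd (J⇔ v)) (bwd (J⇔ v) ∘ map₁ toWitness))
    where
    single⊆ : single w ⊆ to (cl w)
    single⊆ v v∈ = subst (_∈ to (cl w)) (sym (toWitness v∈)) (cl-∈ w)

  sameClosure : Vertex → Subset Vertex
  sameClosure v q = ⌊ cl q Finₚ.≟ bot ⌋ ∨ ⌊ cl q Finₚ.≟ cl v ⌋

  ∈sameClosure : {v q : Vertex} → q ∈ sameClosure v ⇔ ((cl q ≡ bot) ⊎ (cl q ≡ cl v))
  ∈sameClosure {v} {q} =
    mk⇔ (map toWitness toWitness ∘ fwd T-∨′) (bwd T-∨′ ∘ map fromWitness fromWitness)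
    where
    T-∨′ = T-∨ {⌊ cl q Finₚ.≟ bot ⌋} {⌊ cl q Finₚ.≟ cl v ⌋}

  -- A face inside sameClosure v has at most one vertex, whose closure is cl v; a face {x₀, p}
  -- is then obtained by adding one of x₀, p to the flat spanned by the other.
  sameClosure-isFlat : (v : Vertex) → IsFlat C (sameClosure v)
  sameClosure-isFlat v I I-face I⊆ p p∉ J J⇔ = J-face (finite-any? (proj₁ sc) (λ q → T? (I q)))
    where
    p-nonloop : Nonloop p
    p-nonloop = p∉ ∘ bwd ∈sameClosure ∘ inj₁
    cp≢cv : cl p ≢ cl v
    cp≢cv = p∉ ∘ bwd ∈sameClosure ∘ inj₂
    I-cl : ∀ {q} → q ∈ I → cl q ≡ cl v
    I-cl q∈I with fwd ∈sameClosure (I⊆ _ q∈I)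
    ... | inj₁ cq≡bot = ⊥-elim (face-nonloop I-face q∈I cq≡bot)
    ... | inj₂ cq≡cv  = cq≡cv
    J-face : Dec (∃ (_∈ I)) → H C J
    J-face (no I-empty) = face-⊆-closed C sc J⊆single (singleton-isFace p-nonloop)
      where
      J⊆single : J ⊆ single p
      J⊆single q q∈J with fwd (J⇔ q) q∈J
      ... | inj₁ q∈I = ⊥-elim (I-empty (q , q∈I))
      ... | inj₂ q≡p = fromWitness q≡p
    J-face (yes (x₀ , x₀∈I)) = pair-case (T? (cl v ≤ᵇ cl p))
      where
      cx₀≡cv : cl x₀ ≡ cl v
      cx₀≡cv = I-cl x₀∈I
      J⇔′ : ∀ q → (q ∈ J) ⇔ ((q ≡ x₀) ⊎ (q ≡ p))
      J⇔′ q = mk⇔ (map₁ I≡x₀ ∘ fwd (J⇔ q)) (bwd (J⇔ q) ∘ map₁ (λ { refl → x₀∈I }))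
        where
        I≡x₀ : q ∈ I → q ≡ x₀
        I≡x₀ q∈I = face-cl-injective I-face q∈I x₀∈I (trans (I-cl q∈I) (sym cx₀≡cv))
      pair-case : Dec (cl v ≤ cl p) → H C J
      pair-case (no cv≰cp)  = pair-isFace p-nonloop (cv≰cp ∘ subst (_≤ cl p) cx₀≡cv)
                                (λ q → mk⇔ (swap ∘ fwd (J⇔′ q)) (bwd (J⇔′ q) ∘ swap))
      pair-case (yes cv≤cp) =
        pair-isFace (face-nonloop I-face x₀∈I)
                    (λ cp≤cx₀ → cp≢cv (≤-antisym (subst (cl p ≤_) cx₀≡cv cp≤cx₀) cv≤cp)) J⇔′

  -- If v ∉ to y then every q ∈ to y lies in the flat sameClosure v but cannot have closure cl v,
  -- so it is a loop.
  cl-isAtom : {v : Vertex} → Nonloop v → IsAtom (cl v)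
  cl-isAtom {v} v-nonloop = v-nonloop , below
    where
    S-flat = sameClosure-isFlat v
    s = from (sameClosure v) S-flat
    cv≤s : cl v ≤ s
    cv≤s = fwd (∈flat⇔cl≤ _ S-flat) (bwd ∈sameClosure (inj₂ refl))
    below : ∀ y → y ≤ cl v → (y ≡ bot) ⊎ (y ≡ cl v)
    below y y≤cv with T? (cl v ≤ᵇ y)
    ... | yes cv≤y = inj₂ (≤-antisym y≤cv cv≤y)
    ... | no  cv≰y = inj₁ (≤-antisym (to-refl y bot to-y⊆to-bot) (minimum y))
      where
      to-y⊆to-bot : to y ⊆ to bot
      to-y⊆to-bot q q∈y
        with fwd ∈sameClosure (bwd (∈flat⇔cl≤ _ S-flat) (≤-trans (cl-least q∈y) (≤-trans y≤cv cv≤s)))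
      ... | inj₁ cq≡bot = bwd ∈to⇔cl≤ (≤-reflexive cq≡bot)
      ... | inj₂ cq≡cv  = ⊥-elim (cv≰y (subst (_≤ y) cq≡cv (cl-least q∈y)))

  clAt : (v : Vertex) → Nonloop v → At L
  clAt v v-nonloop = cl v , bwd isAtom⇔IsAtom (cl-isAtom v-nonloop)

  representative : (a : At L) → ∃[ v ] cl v ≡ proj₁ a
  representative a with finite-any? (proj₁ sc) (λ v → cl v Finₚ.≟ proj₁ a)
  ... | yes found = found
  ... | no  none  = ⊥-elim (a≢bot (≤-antisym (to-refl _ bot to-a⊆to-bot) (minimum _)))
    where
    a≢bot = proj₁ (fwd isAtom⇔IsAtom (proj₂ a))
    to-a⊆to-bot : to (proj₁ a) ⊆ to bot
    to-a⊆to-bot q q∈a with proj₂ (fwd isAtom⇔IsAtom (proj₂ a)) (cl q) (cl-least q∈a)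
    ... | inj₁ cq≡bot = bwd ∈to⇔cl≤ (≤-reflexive cq≡bot)
    ... | inj₂ cq≡a   = ⊥-elim (none (q , cq≡a))

  rep : At L → Vertex
  rep a = proj₁ (representative a)

  cl-rep : (a : At L) → cl (rep a) ≡ proj₁ a
  cl-rep a = proj₂ (representative a)

  rep-nonloop : (a : At L) → Nonloop (rep a)
  rep-nonloop a cl≡bot = proj₁ (fwd isAtom⇔IsAtom (proj₂ a)) (trans (sym (cl-rep a)) cl≡bot)

  rep-injective : Injective _≡_ _≡_ rep
  rep-injective {a} {b} eq = ΣT-≡ (trans (sym (cl-rep a)) (trans (cong cl eq) (cl-rep b)))

  clImage : Subset Vertex → Subset (At L)
  clImage Y a = ⌊ finite-any? (proj₁ sc) (λ v → T? (Y v) ×-dec (cl v Finₚ.≟ proj₁ a)) ⌋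

  ∈-clImage : (Y : Subset Vertex) (a : At L) → a ∈ clImage Y ⇔ (∃[ v ] v ∈ Y × cl v ≡ proj₁ a)
  ∈-clImage Y a = mk⇔ toWitness fromWitness

  face⇒clImage-face : {Y : Subset Vertex} → H C Y → H (𝒯 L) (clImage Y)
  face⇒clImage-face {Y} Y-face = 𝒯-face ℓ atoms chain transversal atoms-enumerate
    where
    open FaceChain (faceChain Y-face)
    x∈Y : ∀ i → x i ∈ Y
    x∈Y i = bwd (x-enumerates (x i)) (i , refl)
    atoms : Fin k → At L
    atoms i = clAt (x i) (face-nonloop Y-face (x∈Y i))
    atoms-enumerate : atoms enumerates (clImage Y)
    atoms-enumerate a = mk⇔
      (λ a∈ → let (v , v∈Y , cv≡a) = fwd (∈-clImage Y a) a∈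
                  (i , xi≡v) = fwd (x-enumerates v) v∈Y
              in i , ΣT-≡ (trans (cong cl xi≡v) cv≡a))
      (λ { (i , refl) → bwd (∈-clImage Y (atoms i)) (x i , x∈Y i , refl) })

  clImage-face⇒face : {Y : Subset Vertex} → (∀ v → v ∈ Y → Nonloop v) →
                      (∀ {u w} → u ∈ Y → w ∈ Y → cl u ≡ cl w → u ≡ w) →
                      H (𝒯 L) (clImage Y) → H C Y
  clImage-face⇒face {Y} Y-nonloop cl-injective (m , c , strict , e , e-injective , enum , tr) =
    transversal-isFace C sc (to-flat ∘ c) (λ i → to-mono _ _ (proj₁ (strict i)))
      (u , u-injective , u-enumerates , u-transversal)
    where
    witness : ∀ i → ∃[ v ] v ∈ Y × cl v ≡ proj₁ (e i)
    witness i = fwd (∈-clImage Y (e i)) (bwd (enum (e i)) (i , refl))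
    u : Fin m → Vertex
    u i = proj₁ (witness i)
    cl-u : ∀ i → cl (u i) ≡ proj₁ (e i)
    cl-u i = proj₂ (proj₂ (witness i))
    u-transversal : ∀ i → (u i ∈ to (c (suc i))) × (u i ∉ to (c (inject₁ i)))
    u-transversal i = bwd ∈to⇔cl≤ (subst (_≤ c (suc i)) (sym (cl-u i)) (proj₁ (tr i)))
                    , λ u∈ → proj₂ (tr i) (subst (_≤ c (inject₁ i)) (cl-u i) (cl-least u∈))
    u-injective : Injective _≡_ _≡_ u
    u-injective {i} {j} eq = e-injective (ΣT-≡ (trans (sym (cl-u i)) (trans (cong cl eq) (cl-u j))))
    u-enumerates : u enumerates Y
    u-enumerates v = mk⇔ hit (λ { (i , refl) → proj₁ (proj₂ (witness i)) })
      where
      hit : v ∈ Y → ∃[ i ] u i ≡ v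
      hit v∈Y = let a = clAt v (Y-nonloop v v∈Y)
                    (i , ei≡a) = fwd (enum a) (bwd (∈-clImage Y a) (v , v∈Y , refl))
                in i , cl-injective (proj₁ (proj₂ (witness i))) v∈Y (trans (cl-u i) (cong proj₁ ei≡a))

  clImage-insert : {I J : Subset Vertex} {p : Vertex} (p-nonloop : Nonloop p) →
                   (∀ v → (v ∈ J) ⇔ ((v ∈ I) ⊎ (v ≡ p))) →
                   ∀ a → (a ∈ clImage J) ⇔ ((a ∈ clImage I) ⊎ (a ≡ clAt p p-nonloop))
  clImage-insert {I} {J} {p} p-nonloop J⇔ a = mk⇔ into onto
    where
    into : a ∈ clImage J → (a ∈ clImage I) ⊎ (a ≡ clAt p p-nonloop)
    into a∈ with fwd (∈-clImage J a) a∈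
    ... | v , v∈J , cv≡a with fwd (J⇔ v) v∈J
    ...   | inj₁ v∈I = inj₁ (bwd (∈-clImage I a) (v , v∈I , cv≡a))
    ...   | inj₂ refl = inj₂ (ΣT-≡ (sym cv≡a))
    onto : (a ∈ clImage I) ⊎ (a ≡ clAt p p-nonloop) → a ∈ clImage J
    onto (inj₁ a∈) = let (v , v∈I , cv≡a) = fwd (∈-clImage I a) a∈ in
                     bwd (∈-clImage J a) (v , bwd (J⇔ v) (inj₁ v∈I) , cv≡a)
    onto (inj₂ refl) = bwd (∈-clImage J a) (p , bwd (J⇔ p) (inj₂ refl) , refl)

  module _ (F : Subset (At L)) (F-flat : IsFlat (𝒯 L) F) where
    private
      F̂ : Subset (Fin n)
      F̂ = extend (isAtom L) F
      ∈F̂⇔ : (a : At L) → proj₁ a ∈ F̂ ⇔ a ∈ F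
      ∈F̂⇔ a = ∈-extend (isAtom L) F (proj₂ a)

    clPreimage : Subset Vertex
    clPreimage v = ⌊ cl v Finₚ.≟ bot ⌋ ∨ F̂ (cl v)

    ∈clPreimage : {v : Vertex} → v ∈ clPreimage ⇔ ((cl v ≡ bot) ⊎ (cl v ∈ F̂))
    ∈clPreimage {v} = mk⇔ (map₁ toWitness ∘ fwd T-∨′) (bwd T-∨′ ∘ map₁ fromWitness)
      where
      T-∨′ = T-∨ {⌊ cl v Finₚ.≟ bot ⌋} {F̂ (cl v)}

    -- J = I ∪ {p} corresponds to clImage I ∪ {cl p}, a face because F is a flat of 𝒯_L.
    clPreimage-isFlat : IsFlat C clPreimage
    clPreimage-isFlat I I-face I⊆ p p∉ J J⇔ =
      clImage-face⇒face J-nonloop J-cl-injective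
        (F-flat (clImage I) (face⇒clImage-face I-face) image⊆F
                (clAt p p-nonloop) (cp∉F̂ ∘ bwd (∈F̂⇔ _)) (clImage J) (clImage-insert p-nonloop J⇔))
      where
      p-nonloop : Nonloop p
      p-nonloop = p∉ ∘ bwd ∈clPreimage ∘ inj₁
      cp∉F̂ : cl p ∉ F̂
      cp∉F̂ = p∉ ∘ bwd ∈clPreimage ∘ inj₂
      I-F̂ : ∀ {v} → v ∈ I → cl v ∈ F̂
      I-F̂ v∈I with fwd ∈clPreimage (I⊆ _ v∈I)
      ... | inj₁ cv≡bot = ⊥-elim (face-nonloop I-face v∈I cv≡bot)
      ... | inj₂ cv∈F̂   = cv∈F̂
      image⊆F : clImage I ⊆ F
      image⊆F a a∈ = let (v , v∈I , cv≡a) = fwd (∈-clImage I a) a∈ in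
                     fwd (∈F̂⇔ a) (subst (_∈ F̂) cv≡a (I-F̂ v∈I))
      J-nonloop : ∀ v → v ∈ J → Nonloop v
      J-nonloop v v∈J with fwd (J⇔ v) v∈J
      ... | inj₁ v∈I  = face-nonloop I-face v∈I
      ... | inj₂ refl = p-nonloop
      J-cl-injective : ∀ {u w} → u ∈ J → w ∈ J → cl u ≡ cl w → u ≡ w
      J-cl-injective {u} {w} u∈J w∈J cl≡ with fwd (J⇔ u) u∈J | fwd (J⇔ w) w∈J
      ... | inj₁ u∈I  | inj₁ w∈I  = face-cl-injective I-face u∈I w∈I cl≡
      ... | inj₁ u∈I  | inj₂ refl = ⊥-elim (cp∉F̂ (subst (_∈ F̂) cl≡ (I-F̂ u∈I)))
      ... | inj₂ refl | inj₁ w∈I  = ⊥-elim (cp∉F̂ (subst (_∈ F̂) (sym cl≡) (I-F̂ w∈I)))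
      ... | inj₂ refl | inj₂ refl = refl

    ξ-from-clPreimage : ξ L (from clPreimage clPreimage-isFlat) ≐ F
    ξ-from-clPreimage =
        (λ a a≤s → fwd (rep∈⇔ a) (bwd (∈flat⇔cl≤ _ clPreimage-isFlat) (subst (_≤ _) (sym (cl-rep a)) a≤s)))
      , (λ a a∈F → subst (_≤ _) (cl-rep a) (fwd (∈flat⇔cl≤ _ clPreimage-isFlat) (bwd (rep∈⇔ a) a∈F)))
      where
      rep∈⇔ : ∀ a → rep a ∈ clPreimage ⇔ a ∈ F
      rep∈⇔ a = mk⇔ (λ r∈ → fwd (∈F̂⇔ a) (subst (_∈ F̂) (cl-rep a) (cl-rep∈F̂ r∈)))
                    (λ a∈F → bwd ∈clPreimage
                               (inj₂ (subst (_∈ F̂) (sym (cl-rep a)) (bwd (∈F̂⇔ a) a∈F))))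
        where
        cl-rep∈F̂ : rep a ∈ clPreimage → cl (rep a) ∈ F̂
        cl-rep∈F̂ r∈ with fwd ∈clPreimage r∈
        ... | inj₁ cl≡bot = ⊥-elim (rep-nonloop a cl≡bot)
        ... | inj₂ cl∈F̂   = cl∈F̂

  ξ-onto : ξ-Onto L
  ξ-onto F F-flat = from _ (clPreimage-isFlat F F-flat) , ξ-from-clPreimage F F-flat

  represented-face⇔face : {X : Subset (At L)} {Y : Subset Vertex} →
                          (∀ v → v ∈ Y → ∃[ a ] a ∈ X × rep a ≡ v) → (∀ a → a ∈ X → rep a ∈ Y) →
                          H (𝒯 L) X ⇔ H C Y
  represented-face⇔face {X} {Y} Y-reps X-reps =
    mk⇔ (clImage-face⇒face Y-nonloop Y-cl-injective ∘ 𝒯-⊆-closed image⊆X)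
        (𝒯-⊆-closed X⊆image ∘ face⇒clImage-face)
    where
    Y-nonloop : ∀ v → v ∈ Y → Nonloop v
    Y-nonloop v v∈Y = let (a , _ , ra≡v) = Y-reps v v∈Y in subst Nonloop ra≡v (rep-nonloop a)
    Y-cl-injective : ∀ {u w} → u ∈ Y → w ∈ Y → cl u ≡ cl w → u ≡ w
    Y-cl-injective u∈Y w∈Y cl≡ with Y-reps _ u∈Y | Y-reps _ w∈Y
    ... | a , _ , refl | b , _ , refl = cong rep (ΣT-≡ (trans (sym (cl-rep a)) (trans cl≡ (cl-rep b))))
    X⊆image : X ⊆ clImage Y
    X⊆image a a∈X = bwd (∈-clImage Y a) (rep a , X-reps a a∈X , cl-rep a)
    image⊆X : clImage Y ⊆ X
    image⊆X b b∈ with fwd (∈-clImage Y b) b∈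
    ... | v , v∈Y , cv≡b with Y-reps v v∈Y
    ...   | a , a∈X , refl = subst (_∈ X) (ΣT-≡ (trans (sym (cl-rep a)) cv≡b)) a∈X

  representatives : Subset Vertex
  representatives v = ⌊ finite-any? (ΣT-finite n (isAtom L)) (λ a → rep a ≟ v) ⌋

  ∈representatives : {v : Vertex} → v ∈ representatives ⇔ (∃[ a ] rep a ≡ v)
  ∈representatives = mk⇔ toWitness fromWitness

  At↔representatives : At L ↔ Σ Vertex (T ∘ representatives)
  At↔representatives = mk↔ₛ′ represent atomOf represent-atomOf atomOf-represent
    where
    represent : At L → Σ Vertex (T ∘ representatives)
    represent a = rep a , bwd ∈representatives (a , refl)
    atomOf : Σ Vertex (T ∘ representatives) → At L
    atomOf (_ , r) = proj₁ (fwd ∈representatives r)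
    represent-atomOf : ∀ q → represent (atomOf q) ≡ q
    represent-atomOf (_ , r) = ΣT-≡ (proj₂ (fwd ∈representatives r))
    atomOf-represent : ∀ a → atomOf (represent a) ≡ a
    atomOf-represent a = rep-injective (proj₂ (fwd ∈representatives (proj₂ (represent a))))

  𝒯≅restriction : ComplexIso (𝒯 L) (restrict C representatives)
  𝒯≅restriction = record
    { φ         = At↔representatives
    ; preserves = λ X → represented-face⇔face (Y-reps X) (X-reps X)
    }
    where
    module φ = Inverse At↔representatives
    Y-reps : ∀ X v → v ∈ extend representatives (X ∘ φ.from) → ∃[ a ] a ∈ X × rep a ≡ v
    Y-reps X v v∈ = let r = extend-⊆ representatives (X ∘ φ.from) v v∈ in
      φ.from (v , r) , fwd (∈-extend representatives (X ∘ φ.from) r) v∈ , cong proj₁ (φ.strictlyInverseˡ (v , r))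
    X-reps : ∀ X a → a ∈ X → rep a ∈ extend representatives (X ∘ φ.from)
    X-reps X a a∈X = bwd (∈-extend representatives (X ∘ φ.from) (proj₂ (φ.to a)))
                         (subst (_∈ X) (sym (φ.strictlyInverseʳ a)) a∈X)

  module _ (simple : IsSimple C) where

    simple-nonloop : (v : Vertex) → Nonloop v
    simple-nonloop v = face-nonloop (simple v v (single v) (λ _ → inj₁ ∘ toWitness)) {v} (fromWitness refl)

    simple-cl-injective : {u w : Vertex} → cl u ≡ cl w → u ≡ w
    simple-cl-injective {u} {w} =
      face-cl-injective pair-face (bwd (∈pair u) (inj₁ refl)) (bwd (∈pair w) (inj₂ refl))
      where
      pair : Subset Vertex
      pair v = ⌊ v ≟ u ⌋ ∨ ⌊ v ≟ w ⌋
      ∈pair : ∀ v → v ∈ pair ⇔ ((v ≡ u) ⊎ (v ≡ w))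
      ∈pair v = mk⇔ (map toWitness toWitness ∘ fwd (T-∨ {⌊ v ≟ u ⌋}))
                    (bwd (T-∨ {⌊ v ≟ u ⌋}) ∘ map fromWitness fromWitness)
      pair-face : H C pair
      pair-face = simple u w pair (fwd ∘ ∈pair)

    At↔Vertex : At L ↔ Vertex
    At↔Vertex = mk↔ₛ′ rep (λ v → clAt v (simple-nonloop v))
                      (λ v → simple-cl-injective (cl-rep (clAt v (simple-nonloop v))))
                      (λ a → ΣT-≡ (cl-rep a))

    𝒯≅C : ComplexIso (𝒯 L) C
    𝒯≅C = record
      { φ         = At↔Vertex
      ; preserves = λ X → represented-face⇔face (λ v v∈ → φ.from v , v∈ , φ.strictlyInverseˡ v)
                                                (λ a a∈X → subst (_∈ X) (sym (φ.strictlyInverseʳ a)) a∈X)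
      }
      where module φ = Inverse At↔Vertex

-- Without atoms L is the one-element lattice, represented by a single loop (𝒯_L has no vertices
-- then, so it is not a simplicial complex).
loopComplex : Complex
loopComplex = record { V = ⊤ ; H = λ X → X tt ≡ false }

loopComplex-isSimplicialComplex : IsSimplicialComplex loopComplex
loopComplex-isSimplicialComplex =
  (1 , mk↔ₛ′ (λ _ → zero) (λ _ → tt) (λ { zero → refl }) (λ _ → refl))
  , tt , ((λ _ → false) , refl) , ⊆-closed
  where
  ⊆-closed : ∀ X Y → X ⊆ Y → Y tt ≡ false → X tt ≡ false
  ⊆-closed X Y X⊆Y Y∌tt with X tt in X∋?tt
  ... | true  = ⊥-elim (subst T Y∌tt (X⊆Y tt (subst T (sym X∋?tt) _)))
  ... | false = refl

loopComplex-booleanRepresentable : BooleanRepresentable loopComplex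
loopComplex-booleanRepresentable X X∌tt =
  0 , (λ _ _ → true) , (λ _ → full-isFlat loopComplex) , (λ ()) , (λ ()) , (λ { {()} })
    , (λ { tt → mk⇔ (λ tt∈X → ⊥-elim (subst T X∌tt tt∈X)) (λ { (() , _) }) }) , λ ()

-- If tt ∉ F, flatness of F would make {tt} a face.
loopComplex-flat : (F : Subset ⊤) → IsFlat loopComplex F → tt ∈ F
loopComplex-flat F F-flat with F tt in F∋?tt
... | true  = _
... | false = true≢false (F-flat (λ _ → false) refl (λ _ ()) tt (subst T F∋?tt) (λ _ → true) tt-only)
  where
  true≢false : true ≢ false
  true≢false ()
  tt-only : ∀ v → T true ⇔ (T false ⊎ v ≡ tt)
  tt-only tt = mk⇔ (λ _ → inj₂ refl) (λ _ → _)

trivial⇒≅loopComplex : (L : FinLattice) → (∀ x → x ≡ FinLattice.bot L) → LatIso L loopComplex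
trivial⇒≅loopComplex L trivial = record
  { to      = λ _ _ → true
  ; to-flat = λ _ → full-isFlat loopComplex
  ; from    = λ _ _ → bot
  ; from-to = λ x _ → sym (trivial x)
  ; to-from = λ F F-flat → (λ { tt _ → loopComplex-flat F F-flat }) , (λ _ _ → _)
  ; to-mono = λ _ _ _ _ _ → _
  ; to-refl = λ x y _ → ≤-reflexive (trans (trivial x) (sym (trivial y)))
  }
  where open LatticeFacts L

iso⇒representable : (L : FinLattice) → Atomistic L → LatIso L (𝒯 L) →
                    Σ[ C ∈ Complex ] IsSimplicialComplex C × BooleanRepresentable C × LatIso L C
iso⇒representable L atomistic ψ with Finₚ.any? (λ x → T? (isAtom L x))
... | yes atom    = 𝒯 L , 𝒯-isSimplicialComplex atom , 𝒯-booleanRepresentable , ψ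
  where open TransversalComplex L
... | no  no-atom = loopComplex , loopComplex-isSimplicialComplex , loopComplex-booleanRepresentable
                  , trivial⇒≅loopComplex L (atomless⇒trivial no-atom)
  where open AtomisticLattice L atomistic

theorem5p2 : (L : FinLattice) → Atomistic L →
    ( ((Σ[ C ∈ Complex ] IsSimplicialComplex C × BooleanRepresentable C × LatIso L C)
         ⇔ LatIso L (𝒯 L))
    × (LatIso L (𝒯 L) ⇔ ξ-Onto L)
    × (ξ-Onto L ⇔ CondIV L) )
    × (∀ C → IsSimplicialComplex C → BooleanRepresentable C → LatIso L C →
         (Σ[ W ∈ Subset (V C) ] ComplexIso (𝒯 L) (restrict C W))
         × (IsSimple C → ComplexIso (𝒯 L) C))
theorem5p2 L atomistic =
  ( mk⇔ (λ (C , sc , br , ψ) → onto⇒iso (ξ-onto L C sc br ψ)) (iso⇒representable L atomistic)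
  , mk⇔ iso⇒onto onto⇒iso
  , mk⇔ onto⇒condIV condIV⇒onto )
  , λ C sc br ψ → (representatives L C sc br ψ , 𝒯≅restriction L C sc br ψ) , 𝒯≅C L C sc br ψ
  where
  open AtomisticLattice L atomistic
  open Representation using (ξ-onto; representatives; 𝒯≅restriction; 𝒯≅C)
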